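{- Let $G$ be a connected graph and let $A, B$ be two linked, disjoint and saturated subsets of $V(G)$. If $N(A\cup B)$ is not a clique, then for every clique $K\subseteq N(A\cup B)$, the set $F(A, V(G)\setminus A)\cup K$ is a clique (and likewise $F(B, V(G)\setminus B)\cup K$ is a clique).
   Context: All graphs are finite, undirected and loopless. For $X\subseteq V(G)$, $N(X)=\{u\in V(G)\setminus X : u\text{ adjacent to some }x\in X\}$, $N[X]=N(X)\cup X$. For $X,Y\subseteq V(G)$, $F(X,Y)=X\cap N[Y]$. A chordless $uv$-path is a $uv$-path that is an induced subgraph. A set $C$ is convex if for all $u,v\in C$ every vertex on a chordless $uv$-path lies in $C$; $\mathrm{cl}(X)$ is the intersection of all convex sets containing $X$. $A,B$ are linked if some vertex of $A$ is adjacent to some vertex of $B$. $A/B=\{v : \mathrm{cl}(B\cup\{v\})\cap A\ne\emptyset\}$. A set $X\subseteq V(G)\setminus(A\cup B)$ is forbidden if $\mathrm{cl}(X)$ meets both $A$ and $B$; $\mathrm{mfs}(A,B)$ is the family of inclusion-minimal forbidden sets. $\sigma(A,B)=\mathrm{cl}\big(A/B\cup\bigcup\{\bigcap_{x\in X}\mathrm{cl}(A\cup\{x\}) : X\in\mathrm{mfs}(A,B)\}\big)$; $S(A,B)=\bigcup_{i\ge0}\sigma(A_i,B_i)$ with $A_0=A$, $B_0=B$, $A_i=\sigma(A_{i-1},B_{i-1})$, $B_i=\sigma(B_{i-1},A_{i-1})$; $A,B$ are saturated if $A=S(A,B)$ and $B=S(B,A)$. -}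

module Defs where

open import Data.Nat using (ℕ; zero; suc)
open import Data.Fin using (Fin; zero; suc; toℕ; fromℕ)
open import Data.Fin.Subset using (Subset; _∈_; _⊆_) public
open import Data.Product using (Σ; ∃; _×_; _,_; proj₁; proj₂)
open import Data.Sum using (_⊎_)
open import Data.Empty using (⊥)
open import Relation.Nullary using (¬_; Dec)
open import Relation.Binary.PropositionalEquality using (_≡_; _≢_)

record Graph : Set₁ where
  field
    n     : ℕ
    _~_   : Fin n → Fin n → Set
    ~-sym : ∀ {u v} → u ~ v → v ~ u
    ~-irr : ∀ v → ¬ (v ~ v)
    ~-dec : ∀ u v → Dec (u ~ v)

module GraphDefs (G : Graph) where
  open Graph G

  V : Set
  V = Fin n

  VSet : Set₁
  VSet = V → Set

  ⟦_⟧ : Subset n → VSet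
  ⟦ X ⟧ v = v ∈ X

  _∪_ : VSet → VSet → VSet
  (X ∪ Y) v = X v ⊎ Y v

  _∩_ : VSet → VSet → VSet
  (X ∩ Y) v = X v × Y v

  ∁ : VSet → VSet
  ∁ X v = ¬ X v

  ｛_｝ : V → VSet
  ｛ x ｝ v = v ≡ x

  _⊆′_ : VSet → VSet → Set
  X ⊆′ Y = ∀ v → X v → Y v

  _≐_ : VSet → VSet → Set
  X ≐ Y = (X ⊆′ Y) × (Y ⊆′ X)

  N : VSet → VSet
  N X u = ¬ X u × ∃ λ x → X x × (x ~ u)

  N[_] : VSet → VSet
  N[ X ] = X ∪ N X

  F : VSet → VSet → VSet
  F X Y = X ∩ N[ Y ]

  Clique : VSet → Set
  Clique X = ∀ u v → X u → X v → u ≢ v → u ~ v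

  Linked : VSet → VSet → Set
  Linked A B = ∃ λ a → ∃ λ b → A a × B b × (a ~ b)

  Disjoint : VSet → VSet → Set
  Disjoint A B = ∀ v → A v → B v → ⊥

  record Walk (u v : V) : Set where
    field
      len  : ℕ
      walk : Fin (suc len) → V
      start : walk zero ≡ u
      end   : walk (fromℕ len) ≡ v
      step  : ∀ i j → toℕ j ≡ suc (toℕ i) → walk i ~ walk j

  Connected : Set
  Connected = ∀ u v → Walk u v

  record ChordlessPath (u v : V) : Set where
    field
      len   : ℕ
      path  : Fin (suc len) → V
      start : path zero ≡ u
      end   : path (fromℕ len) ≡ v
      inj   : ∀ i j → path i ≡ path j → i ≡ j
      step  : ∀ i j → toℕ j ≡ suc (toℕ i) → path i ~ path j
      induced : ∀ i j → path i ~ path j →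
                toℕ j ≡ suc (toℕ i) ⊎ toℕ i ≡ suc (toℕ j)

  Convex : Subset n → Set
  Convex C = ∀ u v → u ∈ C → v ∈ C → (P : ChordlessPath u v) →
             ∀ i → ChordlessPath.path P i ∈ C

  cl : VSet → VSet
  cl X v = ∀ (C : Subset n) → Convex C → X ⊆′ ⟦ C ⟧ → v ∈ C

  _/_ : VSet → VSet → VSet
  (A / B) v = ∃ λ a → A a × cl (B ∪ ｛ v ｝) a

  Forbidden : VSet → VSet → Subset n → Set
  Forbidden A B X =
    (∀ x → x ∈ X → ¬ A x × ¬ B x) ×
    (∃ λ a → A a × cl ⟦ X ⟧ a) ×
    (∃ λ b → B b × cl ⟦ X ⟧ b)

  MinForbidden : VSet → VSet → Subset n → Set
  MinForbidden A B X =
    Forbidden A B X × (∀ Y → Y ⊆ X → Forbidden A B Y → X ⊆ Y)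

  MfsPart : VSet → VSet → VSet
  MfsPart A B v = ∃ λ (X : Subset n) →
    MinForbidden A B X × (∀ x → x ∈ X → cl (A ∪ ｛ x ｝) v)

  σ : VSet → VSet → VSet
  σ A B = cl ((A / B) ∪ MfsPart A B)

  seqAB : VSet → VSet → ℕ → VSet × VSet
  seqAB A B zero = A , B
  seqAB A B (suc i) =
    let Ai = proj₁ (seqAB A B i) ; Bi = proj₂ (seqAB A B i)
    in σ Ai Bi , σ Bi Ai

  S : VSet → VSet → VSet
  S A B v = ∃ λ i → σ (proj₁ (seqAB A B i)) (proj₂ (seqAB A B i)) v

  Saturated : VSet → VSet → Set
  Saturated A B = (A ≐ S A B) × (B ≐ S B A)

  Corollary17 : Set
  Corollary17 =
    Connected →
    (A B : Subset n) →
    Linked ⟦ A ⟧ ⟦ B ⟧ → Disjoint ⟦ A ⟧ ⟦ B ⟧ → Saturated ⟦ A ⟧ ⟦ B ⟧ →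
    ¬ Clique (N (⟦ A ⟧ ∪ ⟦ B ⟧)) →
    (K : Subset n) → ⟦ K ⟧ ⊆′ N (⟦ A ⟧ ∪ ⟦ B ⟧) → Clique ⟦ K ⟧ →
    Clique (F ⟦ A ⟧ (∁ ⟦ A ⟧) ∪ ⟦ K ⟧) × Clique (F ⟦ B ⟧ (∁ ⟦ B ⟧) ∪ ⟦ K ⟧)

{-# OPTIONS --safe #-}
-- Saturation makes A convex, closed under A/B, and closed under the mfs-part of σ(A,B)
-- (symmetrically for B).  In a connected graph a convex set is connected, so two
-- non-adjacent vertices of a hull that both see A are joined by a walk through A, and a
-- chordless shortening of it puts a vertex of A into that hull; this is how vertices are
-- absorbed into A or B.  Consequently every vertex of N(A ∪ B) sees both A and B, a
-- non-adjacent pair p, q in N(A ∪ B) is a minimal forbidden set, and a vertex of A that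
-- sees u but not x in N(A ∪ B) forces u ~ x.  Fix such p, q and let a ∈ A have a neighbour
-- w ∉ A.  If a sees exactly one of p, q, then p ~ q; if it sees both but misses some
-- k ∈ N(A ∪ B), the hull of A ∪ {k} contains p and q and so meets B, putting k into B; if
-- it sees neither, w lies in cl(A ∪ {p}) ∩ cl(A ∪ {q}) and hence in A.  So a sees all of
-- N(A ∪ B), and two non-adjacent such vertices of A would put their common neighbour p
-- into cl A = A.
module Submission where

open import Defs
open import Data.Nat using (zero; suc)
open import Data.Nat.Properties using (suc-injective)
open import Data.Fin using (Fin; zero; suc; toℕ; fromℕ; _≟_)
open import Data.Fin.Properties using (any?)
open import Data.Fin.Subset using (⁅_⁆) renaming (_∪_ to _∪ˢ_)
open import Data.Fin.Subset.Properties using (_∈?_; x∈⁅x⁆; x∈⁅y⁆⇒x≡y; x∈p∪q⁺; x∈p∪q⁻)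
open import Data.List using (List; []; _∷_; length; lookup)
open import Data.List.Relation.Unary.All as All using (All; []; _∷_)
open import Data.List.Relation.Unary.All.Properties using (¬Any⇒All¬)
open import Data.List.Relation.Unary.Any using (Any; here; there) renaming (any? to anyᴸ?)
open import Data.List.Membership.Propositional.Properties using (∈-lookup)
open import Data.Product using (∃; _×_; _,_; proj₁; swap)
open import Data.Sum using (_⊎_; inj₁; inj₂; [_,_]) renaming (map to ⊎-map; map₁ to ⊎-map₁; swap to ⊎-swap)
open import Data.Empty using (⊥-elim)
open import Data.Unit using (⊤; tt)
open import Function using (_∘_; id)
open import Relation.Nullary using (¬_; Dec; yes; no)
open import Relation.Nullary.Decidable using (_×-dec_; _⊎-dec_; decidable-stable)
open import Relation.Binary.PropositionalEquality using (_≡_; _≢_; refl; sym; trans; cong; subst; subst₂)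

module Convexity (G : Graph) where
  open Graph G
  open GraphDefs G

  private variable
    a b k r u v w x y z s t c c′ : V
    P Q R X Y C D : VSet
    ys : List V

  ~⇒≢ : u ~ v → u ≢ v
  ~⇒≢ u~v refl = ~-irr _ u~v

  data WalkIn (P : VSet) : V → V → Set where
    []   : WalkIn P u u
    step : u ~ w → P w → WalkIn P w v → WalkIn P u v

  _++ʷ_ : WalkIn P u w → WalkIn P w v → WalkIn P u v
  [] ++ʷ q = q
  step e p r ++ʷ q = step e p (r ++ʷ q)

  mapʷ : (∀ {v} → P v → Q v) → WalkIn P u v → WalkIn Q u v
  mapʷ f [] = []
  mapʷ f (step e p r) = step e (f p) (mapʷ f r)

  sequence-walk : ∀ m (f : Fin (suc m) → V) → (∀ i j → toℕ j ≡ suc (toℕ i) → f i ~ f j) →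
                  WalkIn (λ _ → ⊤) (f zero) (f (fromℕ m))
  sequence-walk zero    f adj = []
  sequence-walk (suc m) f adj =
    step (adj zero (suc zero) refl) tt (sequence-walk m (f ∘ suc) (λ i j → adj (suc i) (suc j) ∘ cong suc))

  Walk⇒WalkIn : Walk u v → WalkIn (λ _ → ⊤) u v
  Walk⇒WalkIn W = subst₂ (WalkIn _) (Walk.start W) (Walk.end W)
                    (sequence-walk (Walk.len W) (Walk.walk W) (Walk.step W))

  Touches : V → V → Set
  Touches x t = x ≡ t ⊎ x ~ t

  touches? : ∀ x t → Dec (Touches x t)
  touches? x t = (x ≟ t) ⊎-dec ~-dec x t

  Apart : V → V → Set
  Apart x t = ¬ Touches x t

  Chordless : V → List V → Set
  Chordless x []       = ⊤
  Chordless x (y ∷ ys) = x ~ y × All (Apart x) ys × Chordless y ys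

  last : V → List V → V
  last x []       = x
  last x (y ∷ ys) = last y ys

  lookup-last : ∀ x ys → lookup (x ∷ ys) (fromℕ (length ys)) ≡ last x ys
  lookup-last x []       = refl
  lookup-last x (y ∷ ys) = lookup-last y ys

  apart-later : Chordless x (y ∷ ys) → ∀ j → Apart x (lookup ys j)
  apart-later (_ , apart , _) j = All.lookup apart (∈-lookup j)

  head-distinct : Chordless x ys → ∀ j → x ≢ lookup ys j
  head-distinct {ys = _ ∷ _} (x~y , _) zero    = ~⇒≢ x~y
  head-distinct {ys = _ ∷ _} c         (suc j) = apart-later c j ∘ inj₁

  lookup-injective : Chordless x ys → ∀ i j → lookup (x ∷ ys) i ≡ lookup (x ∷ ys) j → i ≡ j
  lookup-injective c zero zero _ = refl
  lookup-injective c zero (suc j) e = ⊥-elim (head-distinct c j e)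
  lookup-injective c (suc i) zero e = ⊥-elim (head-distinct c i (sym e))
  lookup-injective {ys = _ ∷ _} (_ , _ , c) (suc i) (suc j) e = cong suc (lookup-injective c i j e)

  lookup-adjacent : Chordless x ys → ∀ i j → toℕ j ≡ suc (toℕ i) → lookup (x ∷ ys) i ~ lookup (x ∷ ys) j
  lookup-adjacent c zero zero ()
  lookup-adjacent {ys = _ ∷ _} (x~y , _) zero (suc zero) _ = x~y
  lookup-adjacent {ys = _ ∷ _} c zero (suc (suc j)) ()
  lookup-adjacent c (suc i) zero ()
  lookup-adjacent {ys = _ ∷ _} (_ , _ , c) (suc i) (suc j) e = lookup-adjacent c i j (suc-injective e)

  lookup-induced : Chordless x ys → ∀ i j → lookup (x ∷ ys) i ~ lookup (x ∷ ys) j →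
                   toℕ j ≡ suc (toℕ i) ⊎ toℕ i ≡ suc (toℕ j)
  lookup-induced c zero zero a = ⊥-elim (~-irr _ a)
  lookup-induced {ys = _ ∷ _} c zero (suc zero) _ = inj₁ refl
  lookup-induced {ys = _ ∷ _} c zero (suc (suc j)) a = ⊥-elim (apart-later c j (inj₂ a))
  lookup-induced {ys = _ ∷ _} c (suc zero) zero _ = inj₂ refl
  lookup-induced {ys = _ ∷ _} c (suc (suc i)) zero a = ⊥-elim (apart-later c i (inj₂ (~-sym a)))
  lookup-induced {ys = _ ∷ _} (_ , _ , c) (suc i) (suc j) a = ⊎-map (cong suc) (cong suc) (lookup-induced c i j a)

  toChordlessPath : Chordless x ys → ChordlessPath x (last x ys)
  toChordlessPath {x} {ys} c = record
    { len = length ys ; path = lookup (x ∷ ys) ; start = refl ; end = lookup-last x ys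
    ; inj = lookup-injective c ; step = lookup-adjacent c ; induced = lookup-induced c }

  record ChordlessWalk (P : VSet) (x v : V) : Set where
    constructor chordless
    field
      rest      : List V
      induced   : Chordless x rest
      ends-at   : last x rest ≡ v
      inside    : All P rest

  -- x is attached to the suffix starting at the last vertex it touches (equals or sees).
  shortcut : ∀ zs → Chordless z zs → All P (z ∷ zs) → Any (Touches x) (z ∷ zs) → ChordlessWalk P x (last z zs)
  shortcut {x = x} zs c pzs t with anyᴸ? (touches? x) zs
  shortcut []       _           _         _                  | yes ()
  shortcut (_ ∷ zs) (_ , _ , c) (_ ∷ pzs) _                  | yes t = shortcut zs c pzs t
  shortcut zs       c           (_ ∷ pzs) (here (inj₁ refl)) | no _  = chordless zs c refl pzs
  shortcut zs       c           pzs       (here (inj₂ x~z))  | no ¬t =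
    chordless (_ ∷ zs) (x~z , ¬Any⇒All¬ zs ¬t , c) refl pzs
  shortcut zs       _           _         (there t)          | no ¬t = ⊥-elim (¬t t)

  shorten : WalkIn P x v → ChordlessWalk P x v
  shorten [] = chordless [] tt refl []
  shorten (step x~y py W) with shorten W
  ... | chordless ys c refl pys = shortcut ys c (py ∷ pys) (here (inj₂ x~y))

  ⊆-cl : X ⊆′ cl X
  ⊆-cl v Xv _ _ X⊆C = X⊆C v Xv

  cl-mono : X ⊆′ Y → cl X ⊆′ cl Y
  cl-mono X⊆Y v v∈clX C convex Y⊆C = v∈clX C convex (λ t → Y⊆C t ∘ X⊆Y t)

  cl-chordless : Chordless x ys → cl X x → cl X (last x ys) → ∀ i → cl X (lookup (x ∷ ys) i)
  cl-chordless c x∈cl last∈cl i C convex X⊆C =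
    convex _ _ (x∈cl C convex X⊆C) (last∈cl C convex X⊆C) (toChordlessPath c) i

  cl-middle : cl X u → cl X v → u ≢ v → ¬ u ~ v → u ~ w → w ~ v → cl X w
  cl-middle {v = v} u∈cl v∈cl u≢v u≁v u~w w~v =
    cl-chordless {ys = _ ∷ v ∷ []} (u~w , [ u≢v , u≁v ] ∷ [] , w~v , [] , tt) u∈cl v∈cl (suc zero)

  -- The witness is the second vertex of a chordless path shortening the walk.
  cl-meets-interior : cl X u → cl X v → u ≢ v → ¬ u ~ v → WalkIn (R ∪ ｛ v ｝) u v → ∃ λ z → R z × cl X z
  cl-meets-interior u∈cl v∈cl u≢v u≁v W with shorten W
  ... | chordless [] _ u≡v _ = ⊥-elim (u≢v u≡v)
  ... | chordless (y ∷ _) c refl (inj₁ Ry ∷ _) = y , Ry , cl-chordless c u∈cl v∈cl (suc zero)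
  ... | chordless (_ ∷ _) (u~y , _) _ (inj₂ y≡v ∷ _) = ⊥-elim (u≁v (subst (_ ~_) y≡v u~y))

  chordless-walk : Chordless x ys → (∀ i → P (lookup (x ∷ ys) i)) → WalkIn P x (last x ys)
  chordless-walk {ys = []}    _             _     = []
  chordless-walk {ys = _ ∷ _} (x~y , _ , c) P-all = step x~y (P-all (suc zero)) (chordless-walk c (P-all ∘ suc))

  convex-walk : Connected → cl C ⊆′ C → C x → C y → WalkIn C x y
  convex-walk {x = x} {y = y} conn convex Cx Cy with shorten (Walk⇒WalkIn (conn x y))
  ... | chordless _ c refl _ = chordless-walk c (λ i → convex _ (cl-chordless c (⊆-cl _ Cx) (⊆-cl _ Cy) i))

  walk-through : Connected → cl C ⊆′ C → s ~ c → C c → C c′ → c′ ~ t → WalkIn (C ∪ ｛ t ｝) s t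
  walk-through conn convex s~c Cc Cc′ c′~t =
    step s~c (inj₁ Cc) (mapʷ inj₁ (convex-walk conn convex Cc Cc′) ++ʷ step c′~t (inj₂ refl) [])

  cl-meets-convex : Connected → cl C ⊆′ C → cl X s → cl X t → s ≢ t → ¬ s ~ t →
                    s ~ c → C c → C c′ → c′ ~ t → ∃ λ z → C z × cl X z
  cl-meets-convex conn convex s∈cl t∈cl s≢t s≁t s~c Cc Cc′ c′~t =
    cl-meets-interior s∈cl t∈cl s≢t s≁t (walk-through conn convex s~c Cc Cc′ c′~t)

  absorbed : Connected → cl C ⊆′ C → (C / D) ⊆′ C → cl (D ∪ ｛ v ｝) s → cl (D ∪ ｛ v ｝) t → s ≢ t → ¬ s ~ t →
             s ~ c → C c → C c′ → c′ ~ t → C v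
  absorbed conn convex quotient s∈cl t∈cl s≢t s≁t s~c Cc Cc′ c′~t
    with cl-meets-convex conn convex s∈cl t∈cl s≢t s≁t s~c Cc Cc′ c′~t
  ... | z , Cz , z∈cl = quotient _ (z , Cz , z∈cl)

  zero≡fromℕ⇒≡zero : ∀ m (i : Fin (suc m)) → zero ≡ fromℕ m → i ≡ zero
  zero≡fromℕ⇒≡zero zero    zero _  = refl
  zero≡fromℕ⇒≡zero (suc m) _    ()

  ⁅⁆-convex : ∀ q → Convex ⁅ q ⁆
  ⁅⁆-convex q u v u∈q v∈q P i =
    subst (_∈ ⁅ q ⁆) (cong path (sym (zero≡fromℕ⇒≡zero len i closed))) (subst (_∈ ⁅ q ⁆) (sym start) u∈q)
    where
      open ChordlessPath P
      closed : zero ≡ fromℕ len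
      closed = inj zero (fromℕ len) (trans start (trans (x∈⁅y⁆⇒x≡y q u∈q) (sym (trans end (x∈⁅y⁆⇒x≡y q v∈q)))))

  cl-⊆-singleton : X ⊆′ ｛ t ｝ → cl X ⊆′ ｛ t ｝
  cl-⊆-singleton {t = t} X⊆t v v∈cl =
    x∈⁅y⁆⇒x≡y t (v∈cl ⁅ t ⁆ (⁅⁆-convex t) (λ y Xy → subst (_∈ ⁅ t ⁆) (sym (X⊆t y Xy)) (x∈⁅x⁆ t)))

  σ-closed⇒convex : σ X Y ⊆′ X → cl X ⊆′ X
  σ-closed⇒convex σ⊆X v v∈cl = σ⊆X v (cl-mono (λ x Xx → inj₁ (x , Xx , ⊆-cl x (inj₂ refl))) v v∈cl)

  σ-closed⇒quotient : σ X Y ⊆′ X → (X / Y) ⊆′ X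
  σ-closed⇒quotient σ⊆X v v∈X/Y = σ⊆X v (⊆-cl v (inj₁ v∈X/Y))

  σ-closed⇒MfsPart : σ X Y ⊆′ X → MfsPart X Y ⊆′ X
  σ-closed⇒MfsPart σ⊆X v v∈mfs = σ⊆X v (⊆-cl v (inj₂ v∈mfs))

  saturated⇒σ-closed : Saturated X Y → σ X Y ⊆′ X
  saturated⇒σ-closed ((_ , S⊆X) , _) v v∈σ = S⊆X v (0 , v∈σ)

  record NonEdge (X : VSet) : Set where
    constructor nonEdge
    field
      p q : V
      p∈X : X p
      q∈X : X q
      p≢q : p ≢ q
      p≁q : ¬ p ~ q

  ¬Clique⇒¬¬NonEdge : ¬ Clique X → ¬ ¬ NonEdge X
  ¬Clique⇒¬¬NonEdge ¬clique ¬nonEdge =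
    ¬clique λ u v Xu Xv u≢v → decidable-stable (~-dec u v) (¬nonEdge ∘ nonEdge u v Xu Xv u≢v)

  Clique-stable : ¬ ¬ Clique X → Clique X
  Clique-stable ¬¬clique u v Xu Xv u≢v =
    decidable-stable (~-dec u v) λ u≁v → ¬¬clique λ clique → u≁v (clique u v Xu Xv u≢v)

  Clique-⊆ : X ⊆′ Y → Clique Y → Clique X
  Clique-⊆ X⊆Y clique u v Xu Xv = clique u v (X⊆Y u Xu) (X⊆Y v Xv)

  Clique-∪ : Clique X → Clique Y → (∀ {x y} → X x → Y y → x ~ y) → Clique (X ∪ Y)
  Clique-∪ cliqueX _       _   u v (inj₁ Xu) (inj₁ Xv) u≢v = cliqueX u v Xu Xv u≢v
  Clique-∪ _       _       X~Y u v (inj₁ Xu) (inj₂ Yv) _   = X~Y Xu Yv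
  Clique-∪ _       _       X~Y u v (inj₂ Yu) (inj₁ Xv) _   = ~-sym (X~Y Xv Yu)
  Clique-∪ _       cliqueY _   u v (inj₂ Yu) (inj₂ Yv) u≢v = cliqueY u v Yu Yv u≢v

  Linked-sym : Linked X Y → Linked Y X
  Linked-sym (x , y , Xx , Yy , x~y) = y , x , Yy , Xx , ~-sym x~y

  N-∪-comm : N (X ∪ Y) ⊆′ N (Y ∪ X)
  N-∪-comm v (v∉X∪Y , x , x∈X∪Y , x~v) = v∉X∪Y ∘ ⊎-swap , x , ⊎-swap x∈X∪Y , x~v

  neighbour-in : Connected → (C D : Subset n) → cl ⟦ C ⟧ ⊆′ ⟦ C ⟧ → (⟦ C ⟧ / ⟦ D ⟧) ⊆′ ⟦ C ⟧ → Linked ⟦ C ⟧ ⟦ D ⟧ →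
                 N (⟦ C ⟧ ∪ ⟦ D ⟧) v → ∃ λ d → d ∈ D × v ~ d
  neighbour-in {v = v} conn C D convex quotient (c₀ , d₀ , c₀∈C , d₀∈D , c₀~d₀) (v∉C∪D , x , x∈C∪D , x~v)
    with any? (λ d → (d ∈? D) ×-dec ~-dec v d) | x∈C∪D
  ... | yes found | _        = found
  ... | no none   | inj₂ x∈D = ⊥-elim (none (x , x∈D , ~-sym x~v))
  ... | no none   | inj₁ x∈C = ⊥-elim (v∉C∪D (inj₁ v∈C))
    where
      v∈C : v ∈ C
      v∈C = absorbed conn convex quotient (⊆-cl v (inj₂ refl)) (⊆-cl d₀ (inj₁ d₀∈D))
              (λ { refl → v∉C∪D (inj₂ d₀∈D) }) (λ v~d₀ → none (d₀ , d₀∈D , v~d₀))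
              (~-sym x~v) x∈C c₀∈C c₀~d₀

  ∈-pair⁻ : ∀ {p q} → x ∈ ⁅ p ⁆ ∪ˢ ⁅ q ⁆ → x ≡ p ⊎ x ≡ q
  ∈-pair⁻ {p = p} {q} x∈pair = ⊎-map (x∈⁅y⁆⇒x≡y p) (x∈⁅y⁆⇒x≡y q) (x∈p∪q⁻ ⁅ p ⁆ ⁅ q ⁆ x∈pair)

  pair-member : ∀ {Y : Subset n} → ¬ C r → (∀ {y} → y ∈ Y → y ≡ s ⊎ y ≡ r) → (∃ λ c → C c × cl ⟦ Y ⟧ c) → s ∈ Y
  pair-member {C = C} {r = r} {s = s} {Y = Y} ¬Cr Y⊆pair (c , Cc , c∈clY) =
    decidable-stable (s ∈? Y) λ s∉Y → ¬Cr (subst C (cl-⊆-singleton (Y⊆r s∉Y) c c∈clY) Cc)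
    where
      Y⊆r : ¬ s ∈ Y → ⟦ Y ⟧ ⊆′ ｛ r ｝
      Y⊆r s∉Y y y∈Y = [ (λ { refl → ⊥-elim (s∉Y y∈Y) }) , id ] (Y⊆pair y∈Y)

  module SaturatedPair (conn : Connected) (A B : Subset n) (link : Linked ⟦ A ⟧ ⟦ B ⟧)
                       (σA⊆A : σ ⟦ A ⟧ ⟦ B ⟧ ⊆′ ⟦ A ⟧) (σB⊆B : σ ⟦ B ⟧ ⟦ A ⟧ ⊆′ ⟦ B ⟧) where

    M : VSet
    M = N (⟦ A ⟧ ∪ ⟦ B ⟧)

    ∉A : M v → ¬ v ∈ A
    ∉A (v∉A∪B , _) = v∉A∪B ∘ inj₁

    ∉B : M v → ¬ v ∈ B
    ∉B (v∉A∪B , _) = v∉A∪B ∘ inj₂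

    convexA : cl ⟦ A ⟧ ⊆′ ⟦ A ⟧
    convexA = σ-closed⇒convex σA⊆A

    convexB : cl ⟦ B ⟧ ⊆′ ⟦ B ⟧
    convexB = σ-closed⇒convex σB⊆B

    quotientA : (⟦ A ⟧ / ⟦ B ⟧) ⊆′ ⟦ A ⟧
    quotientA = σ-closed⇒quotient σA⊆A

    quotientB : (⟦ B ⟧ / ⟦ A ⟧) ⊆′ ⟦ B ⟧
    quotientB = σ-closed⇒quotient σB⊆B

    absorbed-into-A : cl (⟦ B ⟧ ∪ ｛ v ｝) s → cl (⟦ B ⟧ ∪ ｛ v ｝) t → s ≢ t → ¬ s ~ t →
                      s ~ c → c ∈ A → c′ ∈ A → c′ ~ t → v ∈ A
    absorbed-into-A = absorbed conn convexA quotientA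

    absorbed-into-B : cl (⟦ A ⟧ ∪ ｛ v ｝) s → cl (⟦ A ⟧ ∪ ｛ v ｝) t → s ≢ t → ¬ s ~ t →
                      s ~ c → c ∈ B → c′ ∈ B → c′ ~ t → v ∈ B
    absorbed-into-B = absorbed conn convexB quotientB

    B-neighbour : M v → ∃ λ b → b ∈ B × v ~ b
    B-neighbour = neighbour-in conn A B convexA quotientA link

    A-neighbour : M v → ∃ λ a → a ∈ A × v ~ a
    A-neighbour v∈M = neighbour-in conn B A convexB quotientB (Linked-sym link) (N-∪-comm _ v∈M)

    edge-sees-M : a ∈ A → b ∈ B → a ~ b → M k → a ~ k
    edge-sees-M {a} {k = k} a∈A b∈B a~b k∈M with ~-dec a k | B-neighbour k∈M
    ... | yes a~k | _ = a~k
    ... | no a≁k  | b′ , b′∈B , k~b′ =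
      ⊥-elim (∉B k∈M (absorbed-into-B (⊆-cl k (inj₂ refl)) (⊆-cl a (inj₁ a∈A))
                                      (λ { refl → ∉A k∈M a∈A }) (a≁k ∘ ~-sym) k~b′ b′∈B b∈B (~-sym a~b)))

    common-B-neighbour : M u → M x → u ≢ x → ¬ u ~ x → ∃ λ b → b ∈ B × b ~ u × b ~ x
    common-B-neighbour {u} {x} u∈M x∈M u≢x u≁x with B-neighbour u∈M
    ... | b , b∈B , u~b with ~-dec b x
    ...   | yes b~x = b , b∈B , ~-sym u~b , b~x
    ...   | no b≁x  = ⊥-elim (∉A x∈M x∈A)
      where
        -- A chordless shortening of the walk b u aᵤ ⋯ aₓ x steps from b either into A or to u.
        x∈A : x ∈ A
        x∈A with A-neighbour u∈M | A-neighbour x∈M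
        ... | aᵤ , aᵤ∈A , u~aᵤ | aₓ , aₓ∈A , x~aₓ
          with cl-meets-interior {X = ⟦ B ⟧ ∪ ｛ x ｝} {R = ⟦ A ⟧ ∪ ｛ u ｝}
                 (⊆-cl b (inj₁ b∈B)) (⊆-cl x (inj₂ refl)) (λ { refl → ∉B x∈M b∈B }) b≁x
                 (step (~-sym u~b) (inj₁ (inj₂ refl))
                   (mapʷ (⊎-map₁ inj₁) (walk-through conn convexA u~aᵤ aᵤ∈A aₓ∈A (~-sym x~aₓ))))
        ... | z , inj₁ z∈A , z∈cl = quotientA x (z , z∈A , z∈cl)
        ... | _ , inj₂ refl , u∈cl = absorbed-into-A u∈cl (⊆-cl x (inj₂ refl)) u≢x u≁x u~aᵤ aᵤ∈A aₓ∈A (~-sym x~aₓ)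

    seen-unseen-adjacent : a ∈ A → M u → M x → a ~ u → ¬ a ~ x → u ~ x
    seen-unseen-adjacent {a} {u} {x} a∈A u∈M x∈M a~u a≁x with ~-dec u x
    ... | yes u~x = u~x
    ... | no u≁x with common-B-neighbour u∈M x∈M (λ { refl → a≁x a~u }) u≁x
    ...   | b , b∈B , b~u , b~x with ~-dec b a
    ...     | yes b~a = ⊥-elim (a≁x (edge-sees-M a∈A b∈B (~-sym b~a) x∈M))
    ...     | no b≁a  = ⊥-elim (∉B x∈M (quotientB x (b , b∈B , b∈cl)))
      where
        -- x b u a is an induced path.
        b∈cl : cl (⟦ A ⟧ ∪ ｛ x ｝) b
        b∈cl = cl-chordless {ys = b ∷ u ∷ a ∷ []}
                 ( ~-sym b~x
                 , [ (λ { refl → a≁x a~u }) , u≁x ∘ ~-sym ] ∷ [ (λ { refl → ∉A x∈M a∈A }) , a≁x ∘ ~-sym ] ∷ []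
                 , b~u , [ (λ { refl → a≁x b~x }) , b≁a ] ∷ []
                 , ~-sym a~u , [] , tt )
                 (⊆-cl x (inj₂ refl)) (⊆-cl a (inj₁ a∈A)) (suc zero)

    module _ (ne : NonEdge M) where
      open NonEdge ne

      pair : Subset n
      pair = ⁅ p ⁆ ∪ˢ ⁅ q ⁆

      pair-mfs : MinForbidden ⟦ A ⟧ ⟦ B ⟧ pair
      pair-mfs = (outside , meets convexA A-neighbour , meets convexB B-neighbour) , minimal
        where
          outside : ∀ x → x ∈ pair → ¬ x ∈ A × ¬ x ∈ B
          outside x x∈pair = [ (λ { refl → ∉A p∈X , ∉B p∈X }) , (λ { refl → ∉A q∈X , ∉B q∈X }) ] (∈-pair⁻ x∈pair)

          meets : ∀ {C} → cl ⟦ C ⟧ ⊆′ ⟦ C ⟧ → (∀ {v} → M v → ∃ λ c → c ∈ C × v ~ c) →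
                  ∃ λ c → c ∈ C × cl ⟦ pair ⟧ c
          meets convex neighbour with neighbour p∈X | neighbour q∈X
          ... | c₁ , c₁∈C , p~c₁ | c₂ , c₂∈C , q~c₂ =
            cl-meets-convex conn convex
              (⊆-cl p (x∈p∪q⁺ (inj₁ (x∈⁅x⁆ p)))) (⊆-cl q (x∈p∪q⁺ {p = ⁅ p ⁆} (inj₂ (x∈⁅x⁆ q))))
              p≢q p≁q p~c₁ c₁∈C c₂∈C (~-sym q~c₂)

          minimal : ∀ Y → Y ⊆ pair → Forbidden ⟦ A ⟧ ⟦ B ⟧ Y → pair ⊆ Y
          minimal Y Y⊆pair (_ , meetsA , _) x∈pair =
            [ (λ { refl → pair-member (∉A q∈X) (∈-pair⁻ ∘ Y⊆pair) meetsA })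
            , (λ { refl → pair-member (∉A p∈X) (⊎-swap ∘ ∈-pair⁻ ∘ Y⊆pair) meetsA }) ] (∈-pair⁻ x∈pair)

      seen-pair⇒seen-M : a ∈ A → a ~ p → a ~ q → M k → a ~ k
      seen-pair⇒seen-M {a} {k} a∈A a~p a~q k∈M with ~-dec a k
      ... | yes a~k = a~k
      ... | no a≁k with B-neighbour p∈X | B-neighbour q∈X
      ...   | b₁ , b₁∈B , p~b₁ | b₂ , b₂∈B , q~b₂ =
        ⊥-elim (∉B k∈M (absorbed-into-B (in-cl p∈X a~p) (in-cl q∈X a~q) p≢q p≁q p~b₁ b₁∈B b₂∈B (~-sym q~b₂)))
        where
          in-cl : M r → a ~ r → cl (⟦ A ⟧ ∪ ｛ k ｝) r
          in-cl r∈M a~r = cl-middle (⊆-cl a (inj₁ a∈A)) (⊆-cl k (inj₂ refl)) (λ { refl → ∉A k∈M a∈A }) a≁k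
                            a~r (seen-unseen-adjacent a∈A r∈M k∈M a~r a≁k)

      unseen-pair⇒∈A : a ∈ A → M w → a ~ w → ¬ a ~ p → ¬ a ~ q → w ∈ A
      unseen-pair⇒∈A {a} {w} a∈A w∈M a~w a≁p a≁q =
        σ-closed⇒MfsPart σA⊆A w (pair , pair-mfs , λ r r∈pair →
          [ (λ { refl → in-cl p∈X a≁p }) , (λ { refl → in-cl q∈X a≁q }) ] (∈-pair⁻ r∈pair))
        where
          in-cl : M r → ¬ a ~ r → cl (⟦ A ⟧ ∪ ｛ r ｝) w
          in-cl r∈M a≁r = cl-middle (⊆-cl a (inj₁ a∈A)) (⊆-cl _ (inj₂ refl)) (λ { refl → ∉A r∈M a∈A }) a≁r
                            a~w (seen-unseen-adjacent a∈A w∈M r∈M a~w a≁r)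

      boundary-complete : F ⟦ A ⟧ (∁ ⟦ A ⟧) a → M k → a ~ k
      boundary-complete (a∈A , inj₁ a∉A) _ = ⊥-elim (a∉A a∈A)
      boundary-complete {a} (a∈A , inj₂ (_ , w , w∉A , w~a)) k∈M with w ∈? B | ~-dec a p | ~-dec a q
      ... | yes w∈B | _       | _       = edge-sees-M a∈A w∈B (~-sym w~a) k∈M
      ... | no _    | yes a~p | yes a~q = seen-pair⇒seen-M a∈A a~p a~q k∈M
      ... | no _    | yes a~p | no a≁q  = ⊥-elim (p≁q (seen-unseen-adjacent a∈A p∈X q∈X a~p a≁q))
      ... | no _    | no a≁p  | yes a~q = ⊥-elim (p≁q (~-sym (seen-unseen-adjacent a∈A q∈X p∈X a~q a≁p)))
      ... | no w∉B  | no a≁p  | no a≁q  =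
        ⊥-elim (w∉A (unseen-pair⇒∈A a∈A ([ w∉A , w∉B ] , a , inj₁ a∈A , ~-sym w~a) (~-sym w~a) a≁p a≁q))

      boundary-clique : Clique (F ⟦ A ⟧ (∁ ⟦ A ⟧))
      boundary-clique u v ∂u ∂v u≢v = decidable-stable (~-dec u v) λ u≁v →
        ∉A p∈X (convexA p (cl-middle (⊆-cl u (proj₁ ∂u)) (⊆-cl v (proj₁ ∂v)) u≢v u≁v
                             (boundary-complete ∂u p∈X) (~-sym (boundary-complete ∂v p∈X))))

    -- Adjacency is decidable, so the goal is stable and a non-edge of M may be extracted.
    boundary∪clique : ¬ Clique M → (K : VSet) → K ⊆′ M → Clique K → Clique (F ⟦ A ⟧ (∁ ⟦ A ⟧) ∪ K)
    boundary∪clique ¬clique K K⊆M K-clique = Clique-stable λ ¬goal → ¬Clique⇒¬¬NonEdge ¬clique λ ne →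
      ¬goal (Clique-∪ (boundary-clique ne) K-clique (λ ∂a k∈K → boundary-complete ne ∂a (K⊆M _ k∈K)))

corollary17 : (G : Graph) → GraphDefs.Corollary17 G
corollary17 G conn A B link _ saturated ¬clique K K⊆N K-clique =
    Side-A.boundary∪clique ¬clique ⟦ K ⟧ K⊆N K-clique
  , Side-B.boundary∪clique (¬clique ∘ Clique-⊆ N-∪-comm) ⟦ K ⟧ (λ v → N-∪-comm v ∘ K⊆N v) K-clique
  where
    open GraphDefs G
    open Convexity G
    σA⊆A = saturated⇒σ-closed saturated
    σB⊆B = saturated⇒σ-closed (swap saturated)
    module Side-A = SaturatedPair conn A B link σA⊆A σB⊆B
    module Side-B = SaturatedPair conn B A (Linked-sym link) σB⊆B σA⊆A
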